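{- Let $f\colon\{ -1,1\}^n \rightarrow \{ -1,1\}$ be a homogeneous Boolean function of degree $d$. Then for any $x \in \{ -1,1\}^n$, $\Delta(f)(x)=d$. In particular, $\mathrm{Inf}[f] = \|\Delta(f)\|_\infty = d$.
   Context: Every $f\colon\{ -1,1\}^n\to\mathbb{R}$ has a unique multilinear polynomial representation; its degree is the degree of this polynomial, and $f$ is homogeneous if all its monomials (with nonzero coefficient) have the same degree. With $x\oplus e_i$ the point $x$ with $i$th coordinate flipped, $f_i(x)=\frac{f(x)-f(x\oplus e_i)}{2}$, $\Delta(f)(x)=\sum_{i=1}^n|f_i(x)|$, $\mathrm{Inf}[f]=\sum_i\mathbb{E}_x|f_i(x)|$ ($x$ uniform on $\{ -1,1\}^n$), and $\|\Delta(f)\|_\infty=\max_x\Delta(f)(x)$. -}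

module Defs where

open import Data.Bool using (Bool; true; false; not; if_then_else_)
open import Data.Nat using (ℕ; zero; suc; _^_)
open import Data.Nat.Properties using (m^n≢0)
open import Data.Integer using (+_)
open import Data.Fin using (Fin)
open import Data.Fin.Subset using (Subset; Side; inside; outside) renaming (∣_∣ to ∣_∣ₛ)
open import Data.Vec using (Vec; []; _∷_; updateAt; replicate; lookup)
open import Data.List using (List; []; _∷_; map; _++_; foldr; allFin)
open import Data.Rational using (ℚ; 0ℚ; 1ℚ; _+_; _*_; _-_; -_; _/_; ∣_∣; _⊔_)
open import Data.Product using (Σ; _×_)
open import Data.Sum using (_⊎_)
open import Relation.Binary.PropositionalEquality using (_≡_; _≢_)

-- Points of {-1,1}^n are encoded as Vec Bool n; the coordinate value
-- of b is  sign b  (true ↦ 1, false ↦ -1).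
Cube : ℕ → Set
Cube n = Vec Bool n

sign : Bool → ℚ
sign true  = 1ℚ
sign false = - 1ℚ

allPoints : (n : ℕ) → List (Cube n)
allPoints zero    = [] ∷ []
allPoints (suc n) = map (true ∷_) (allPoints n) ++ map (false ∷_) (allPoints n)

sumℚ : List ℚ → ℚ
sumℚ = foldr _+_ 0ℚ

𝔼 : (n : ℕ) → (Cube n → ℚ) → ℚ
𝔼 n g = sumℚ (map g (allPoints n)) * _/_ (+ 1) (2 ^ n) {{m^n≢0 2 n}}

Σᵢ : (n : ℕ) → (Fin n → ℚ) → ℚ
Σᵢ n g = sumℚ (map g (allFin n))

Fn : ℕ → Set
Fn n = Cube n → ℚ

IsBoolean : ∀ {n} → Fn n → Set
IsBoolean {n} f = (x : Cube n) → f x ≡ 1ℚ ⊎ f x ≡ - 1ℚ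

χ : ∀ {n} → Subset n → Cube n → ℚ
χ []            []       = 1ℚ
χ (inside ∷ S)  (b ∷ x)  = sign b * χ S x
χ (outside ∷ S) (b ∷ x)  = χ S x

-- coefficient of the monomial x^S in the unique multilinear representation
-- of f (= Fourier coefficient  E_x[f(x) χ_S(x)])
coeff : ∀ {n} → Fn n → Subset n → ℚ
coeff {n} f S = 𝔼 n (λ x → f x * χ S x)

IsHomogeneousOfDegree : ∀ {n} → Fn n → ℕ → Set
IsHomogeneousOfDegree {n} f d =
  Σ (Subset n) (λ S → coeff f S ≢ 0ℚ × ∣ S ∣ₛ ≡ d)
  × ((S : Subset n) → coeff f S ≢ 0ℚ → ∣ S ∣ₛ ≡ d)

flip : ∀ {n} → Cube n → Fin n → Cube n
flip x i = updateAt x i not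

deriv : ∀ {n} → Fn n → Fin n → Cube n → ℚ
deriv f i x = (f x - f (flip x i)) * (+ 1 / 2)

Δ : ∀ {n} → Fn n → Cube n → ℚ
Δ {n} f x = Σᵢ n (λ i → ∣ deriv f i x ∣)

Inf : ∀ {n} → Fn n → ℚ
Inf {n} f = Σᵢ n (λ i → 𝔼 n (λ x → ∣ deriv f i x ∣))

-- ‖g‖_∞ = max_x |g(x)|  (the cube is nonempty; fold starts at a point)
supNorm : ∀ {n} → (Cube n → ℚ) → ℚ
supNorm {n} g = foldr (λ x m → ∣ g x ∣ ⊔ m) ∣ g (replicate n true) ∣ (allPoints n)

ℕtoℚ : ℕ → ℚ
ℕtoℚ d = + d / 1

-- Since f is ±1-valued, |f_i(x)| = f(x) f_i(x), so Δ(f)(x) = f(x) · L f(x) for the Laplacian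
-- L f = Σ_i f_i. Each character is an eigenfunction of L, with L χ_S = |S| χ_S, so a homogeneous
-- f of degree d satisfies L f = d f, and Δ(f)(x) = d f(x)² = d. Both Inf[f] = 𝔼[Δ(f)] and
-- ‖Δ(f)‖_∞ are then averages or maxima of the constant d.
-- The identity L f = d f is checked coefficientwise: a function on the cube all of whose
-- Fourier coefficients vanish is zero, by induction on n, splitting on the first coordinate.
module Submission where

open import Data.Bool using (true; false)
open import Data.Fin using (Fin; zero; suc)
open import Data.Fin.Subset using (Subset; Side; inside; outside) renaming (∣_∣ to ∣_∣ₛ)
import Data.Integer as ℤ
import Data.Integer.Properties as ℤP
open import Data.List using (List; []; _∷_; map; _++_; foldr; length; allFin)
open import Data.List.Properties using (map-cong; map-∘; map-tabulate; length-++; length-map)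
open import Data.Nat as ℕ using (ℕ; zero; suc; _^_; NonZero)
open import Data.Nat.Coprimality using (1-coprimeTo) renaming (sym to coprime-sym)
open import Data.Nat.Properties using (m^n≢0; +-identityʳ)
open import Data.Product using (_×_; _,_; proj₁; proj₂)
open import Data.Rational using (ℚ; mkℚ; 0ℚ; 1ℚ; ½; _+_; _*_; _-_; -_; _/_; ∣_∣; _⊔_)
open import Data.Rational.Properties
  using ( normalize-coprime; /-cong; _≟_; ⊔-idem; +-comm; +-assoc; +-identityˡ
        ; *-comm; *-identityˡ; *-identityʳ; *-zeroˡ; *-zeroʳ; *-distribˡ-+; *-inverseʳ )
open import Data.Rational.Solver using (module +-*-Solver)
open import Data.Sum using (_⊎_; inj₁; inj₂)
open import Data.Vec using ([]; _∷_; lookup; replicate)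
open import Function using (_∘_)
open import Relation.Binary.PropositionalEquality
open import Relation.Nullary using (yes; no)

open import Defs

open +-*-Solver
open ≡-Reasoning

private
  variable
    A B : Set

ℕtoℚ≡mkℚ : ∀ n → ℕtoℚ n ≡ mkℚ (ℤ.+ n) 0 (coprime-sym (1-coprimeTo n))
ℕtoℚ≡mkℚ n = normalize-coprime (coprime-sym (1-coprimeTo n))

ℕtoℚ-+ : ∀ m n → ℕtoℚ (m ℕ.+ n) ≡ ℕtoℚ m + ℕtoℚ n
ℕtoℚ-+ m n rewrite ℕtoℚ≡mkℚ m | ℕtoℚ≡mkℚ n =
  /-cong {ℤ.+ (m ℕ.+ n)} (sym (cong₂ ℤ._+_ (ℤP.*-identityʳ (ℤ.+ m)) (ℤP.*-identityʳ (ℤ.+ n)))) refl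

∣ℕtoℚ∣ : ∀ n → ∣ ℕtoℚ n ∣ ≡ ℕtoℚ n
∣ℕtoℚ∣ n = trans (cong ∣_∣ (ℕtoℚ≡mkℚ n)) (sym (ℕtoℚ≡mkℚ n))

ℕtoℚ-inverseʳ : ∀ m .{{_ : NonZero m}} → ℕtoℚ m * (ℤ.+ 1 / m) ≡ 1ℚ
ℕtoℚ-inverseʳ m@(suc _) =
  trans (cong₂ _*_ (ℕtoℚ≡mkℚ m) (normalize-coprime (1-coprimeTo m)))
        (*-inverseʳ (mkℚ (ℤ.+ m) 0 (coprime-sym (1-coprimeTo m))))

sumOf : (A → ℚ) → List A → ℚ
sumOf g xs = sumℚ (map g xs)

sumOf-cong : ∀ {g h : A → ℚ} → (∀ x → g x ≡ h x) → ∀ xs → sumOf g xs ≡ sumOf h xs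
sumOf-cong g≗h xs = cong sumℚ (map-cong g≗h xs)

sumOf-map : ∀ (g : B → ℚ) (h : A → B) xs → sumOf g (map h xs) ≡ sumOf (λ x → g (h x)) xs
sumOf-map g h xs = cong sumℚ (sym (map-∘ xs))

sumOf-++ : ∀ (g : A → ℚ) xs ys → sumOf g (xs ++ ys) ≡ sumOf g xs + sumOf g ys
sumOf-++ g []       ys = sym (+-identityˡ _)
sumOf-++ g (x ∷ xs) ys = trans (cong (g x +_) (sumOf-++ g xs ys)) (sym (+-assoc (g x) _ _))

sumOf-+ : ∀ (g h : A → ℚ) xs → sumOf (λ x → g x + h x) xs ≡ sumOf g xs + sumOf h xs
sumOf-+ g h []       = refl
sumOf-+ g h (x ∷ xs) = trans (cong (g x + h x +_) (sumOf-+ g h xs))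
  (solve 4 (λ a b c d → (a :+ b) :+ (c :+ d) := (a :+ c) :+ (b :+ d)) refl (g x) (h x) (sumOf g xs) (sumOf h xs))

sumOf-*ˡ : ∀ c (g : A → ℚ) xs → sumOf (λ x → c * g x) xs ≡ c * sumOf g xs
sumOf-*ˡ c g []       = sym (*-zeroʳ c)
sumOf-*ˡ c g (x ∷ xs) = trans (cong (c * g x +_) (sumOf-*ˡ c g xs)) (sym (*-distribˡ-+ c (g x) _))

sumOf-*ʳ : ∀ c (g : A → ℚ) xs → sumOf (λ x → g x * c) xs ≡ sumOf g xs * c
sumOf-*ʳ c g xs = trans (sumOf-cong (λ x → *-comm (g x) c) xs) (trans (sumOf-*ˡ c g xs) (*-comm c _))

sumOf-const : ∀ c (xs : List A) → sumOf (λ _ → c) xs ≡ ℕtoℚ (length xs) * c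
sumOf-const c []       = sym (*-zeroˡ c)
sumOf-const c (x ∷ xs) = begin
  c + sumOf (λ _ → c) xs        ≡⟨ cong (c +_) (sumOf-const c xs) ⟩
  c + ℕtoℚ (length xs) * c      ≡⟨ solve 2 (λ c l → c :+ l :* c := (con 1ℚ :+ l) :* c) refl c (ℕtoℚ (length xs)) ⟩
  (1ℚ + ℕtoℚ (length xs)) * c   ≡⟨ cong (_* c) (sym (ℕtoℚ-+ 1 (length xs))) ⟩
  ℕtoℚ (suc (length xs)) * c    ∎

sumOf-swap : ∀ (G : A → B → ℚ) xs ys →
  sumOf (λ x → sumOf (G x) ys) xs ≡ sumOf (λ y → sumOf (λ x → G x y) xs) ys
sumOf-swap G xs []       = trans (sumOf-const 0ℚ xs) (*-zeroʳ (ℕtoℚ (length xs)))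
sumOf-swap G xs (y ∷ ys) = trans (sumOf-+ (λ x → G x y) (λ x → sumOf (G x) ys) xs)
  (cong (sumOf (λ x → G x y) xs +_) (sumOf-swap G xs ys))

Σᵢ-suc : ∀ n (g : Fin (suc n) → ℚ) → Σᵢ (suc n) g ≡ g zero + Σᵢ n (λ i → g (suc i))
Σᵢ-suc n g = cong sumℚ (trans (map-tabulate (λ i → i) g)
  (cong (g zero ∷_) (sym (map-tabulate (λ i → i) (λ i → g (suc i))))))

cubeSum : (n : ℕ) → (Cube n → ℚ) → ℚ
cubeSum n g = sumOf g (allPoints n)

cubeSum-suc : ∀ n (g : Cube (suc n) → ℚ) →
  cubeSum (suc n) g ≡ cubeSum n (λ x → g (true ∷ x)) + cubeSum n (λ x → g (false ∷ x))
cubeSum-suc n g = trans (sumOf-++ g (map (true ∷_) (allPoints n)) _)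
  (cong₂ _+_ (sumOf-map g (true ∷_) (allPoints n)) (sumOf-map g (false ∷_) (allPoints n)))

cubeSum-flip : ∀ n (g : Cube n → ℚ) i → cubeSum n (λ x → g (flip x i)) ≡ cubeSum n g
cubeSum-flip (suc n) g zero = begin
  cubeSum (suc n) (λ x → g (flip x zero))                       ≡⟨ cubeSum-suc n _ ⟩
  cubeSum n (λ x → g (false ∷ x)) + cubeSum n (λ x → g (true ∷ x)) ≡⟨ +-comm (cubeSum n (λ x → g (false ∷ x))) _ ⟩
  cubeSum n (λ x → g (true ∷ x)) + cubeSum n (λ x → g (false ∷ x)) ≡⟨ cubeSum-suc n g ⟨
  cubeSum (suc n) g                                              ∎
cubeSum-flip (suc n) g (suc i) = begin
  cubeSum (suc n) (λ x → g (flip x (suc i)))                     ≡⟨ cubeSum-suc n _ ⟩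
  cubeSum n (λ x → g (true ∷ flip x i)) + cubeSum n (λ x → g (false ∷ flip x i))
    ≡⟨ cong₂ _+_ (cubeSum-flip n (λ x → g (true ∷ x)) i) (cubeSum-flip n (λ x → g (false ∷ x)) i) ⟩
  cubeSum n (λ x → g (true ∷ x)) + cubeSum n (λ x → g (false ∷ x)) ≡⟨ cubeSum-suc n g ⟨
  cubeSum (suc n) g                                              ∎

length-allPoints : ∀ n → length (allPoints n) ≡ 2 ^ n
length-allPoints zero    = refl
length-allPoints (suc n) = begin
  length (map (true ∷_) (allPoints n) ++ map (false ∷_) (allPoints n))
    ≡⟨ length-++ (map (true ∷_) (allPoints n)) ⟩
  length (map (true ∷_) (allPoints n)) ℕ.+ length (map (false ∷_) (allPoints n))
    ≡⟨ cong₂ ℕ._+_ (length-map (true ∷_) (allPoints n)) (length-map (false ∷_) (allPoints n)) ⟩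
  length (allPoints n) ℕ.+ length (allPoints n)
    ≡⟨ cong (λ m → m ℕ.+ m) (length-allPoints n) ⟩
  2 ^ n ℕ.+ 2 ^ n
    ≡⟨ cong (2 ^ n ℕ.+_) (+-identityʳ (2 ^ n)) ⟨
  2 ^ suc n ∎

uniformWeight : ℕ → ℚ
uniformWeight n = _/_ (ℤ.+ 1) (2 ^ n) {{m^n≢0 2 n}}

2^n*uniformWeight≡1 : ∀ n → ℕtoℚ (2 ^ n) * uniformWeight n ≡ 1ℚ
2^n*uniformWeight≡1 n = ℕtoℚ-inverseʳ (2 ^ n) {{m^n≢0 2 n}}

𝔼-const : ∀ n {g : Cube n → ℚ} {c} → (∀ x → g x ≡ c) → 𝔼 n g ≡ c
𝔼-const n {g} {c} g≡c = begin
  cubeSum n g * uniformWeight n                       ≡⟨ cong (_* uniformWeight n) (sumOf-cong g≡c (allPoints n)) ⟩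
  cubeSum n (λ _ → c) * uniformWeight n               ≡⟨ cong (_* uniformWeight n) (sumOf-const c (allPoints n)) ⟩
  ℕtoℚ (length (allPoints n)) * c * uniformWeight n   ≡⟨ cong (λ m → ℕtoℚ m * c * uniformWeight n) (length-allPoints n) ⟩
  ℕtoℚ (2 ^ n) * c * uniformWeight n
    ≡⟨ solve 3 (λ N c w → N :* c :* w := c :* (N :* w)) refl (ℕtoℚ (2 ^ n)) c (uniformWeight n) ⟩
  c * (ℕtoℚ (2 ^ n) * uniformWeight n)                ≡⟨ cong (c *_) (2^n*uniformWeight≡1 n) ⟩
  c * 1ℚ                                              ≡⟨ *-identityʳ c ⟩
  c                                                   ∎

flip-involutive : ∀ {n} (x : Cube n) i → flip (flip x i) i ≡ x
flip-involutive (true  ∷ x) zero    = refl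
flip-involutive (false ∷ x) zero    = refl
flip-involutive (b     ∷ x) (suc i) = cong (b ∷_) (flip-involutive x i)

flipSign : Side → ℚ
flipSign inside  = - 1ℚ
flipSign outside = 1ℚ

indicator : Side → ℚ
indicator inside  = 1ℚ
indicator outside = 0ℚ

χ-flip : ∀ {n} (S : Subset n) x i → χ S (flip x i) ≡ flipSign (lookup S i) * χ S x
χ-flip (inside  ∷ S) (true  ∷ x) zero    = solve 1 (λ c → con (- 1ℚ) :* c := con (- 1ℚ) :* (con 1ℚ :* c)) refl (χ S x)
χ-flip (inside  ∷ S) (false ∷ x) zero    = solve 1 (λ c → con 1ℚ :* c := con (- 1ℚ) :* (con (- 1ℚ) :* c)) refl (χ S x)
χ-flip (outside ∷ S) (b     ∷ x) zero    = sym (*-identityˡ _)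
χ-flip (inside  ∷ S) (b     ∷ x) (suc i) = trans (cong (sign b *_) (χ-flip S x i))
  (solve 3 (λ a s c → a :* (s :* c) := s :* (a :* c)) refl (sign b) (flipSign (lookup S i)) (χ S x))
χ-flip (outside ∷ S) (b     ∷ x) (suc i) = χ-flip S x i

-- coeff f S ≡ scaledCoeff f S * uniformWeight n holds definitionally.
scaledCoeff : ∀ {n} → Fn n → Subset n → ℚ
scaledCoeff {n} g S = cubeSum n (λ x → g x * χ S x)

coeff≡0⇒scaledCoeff≡0 : ∀ {n} (f : Fn n) S → coeff f S ≡ 0ℚ → scaledCoeff f S ≡ 0ℚ
coeff≡0⇒scaledCoeff≡0 {n} f S coeff≡0 = begin
  a                                  ≡⟨ solve 3 (λ a w N → a := (a :* w) :* N :+ a :* (con 1ℚ :- N :* w)) refl a w N ⟩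
  (a * w) * N + a * (1ℚ - N * w)     ≡⟨ cong₂ (λ u v → u * N + a * (1ℚ - v)) coeff≡0 (2^n*uniformWeight≡1 n) ⟩
  0ℚ * N + a * (1ℚ - 1ℚ)             ≡⟨ solve 2 (λ N a → con 0ℚ :* N :+ a :* (con 1ℚ :- con 1ℚ) := con 0ℚ) refl N a ⟩
  0ℚ                                 ∎
  where
  a = scaledCoeff f S
  w = uniformWeight n
  N = ℕtoℚ (2 ^ n)

scaledCoeff-linear : ∀ {n} {g h₁ h₂ : Fn n} b c →
  (∀ x → g x ≡ b * h₁ x + c * h₂ x) →
  ∀ S → scaledCoeff g S ≡ b * scaledCoeff h₁ S + c * scaledCoeff h₂ S
scaledCoeff-linear {n} {g} {h₁} {h₂} b c g≡ S = begin
  scaledCoeff g S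
    ≡⟨ sumOf-cong (λ x → trans (cong (_* χ S x) (g≡ x))
         (solve 5 (λ b c u v χ → (b :* u :+ c :* v) :* χ := b :* (u :* χ) :+ c :* (v :* χ)) refl b c (h₁ x) (h₂ x) (χ S x)))
         (allPoints n) ⟩
  cubeSum n (λ x → b * (h₁ x * χ S x) + c * (h₂ x * χ S x))
    ≡⟨ sumOf-+ _ _ (allPoints n) ⟩
  cubeSum n (λ x → b * (h₁ x * χ S x)) + cubeSum n (λ x → c * (h₂ x * χ S x))
    ≡⟨ cong₂ _+_ (sumOf-*ˡ b _ (allPoints n)) (sumOf-*ˡ c _ (allPoints n)) ⟩
  b * scaledCoeff h₁ S + c * scaledCoeff h₂ S ∎

scaledCoeff-flip : ∀ {n} (f : Fn n) S i →
  scaledCoeff (λ x → f (flip x i)) S ≡ flipSign (lookup S i) * scaledCoeff f S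
scaledCoeff-flip {n} f S i = begin
  cubeSum n (λ x → f (flip x i) * χ S x)                     ≡⟨ cubeSum-flip n (λ x → f (flip x i) * χ S x) i ⟨
  cubeSum n (λ x → f (flip (flip x i) i) * χ S (flip x i))   ≡⟨ sumOf-cong flipped (allPoints n) ⟩
  cubeSum n (λ x → s * (f x * χ S x))                        ≡⟨ sumOf-*ˡ s _ (allPoints n) ⟩
  s * scaledCoeff f S                                        ∎
  where
  s = flipSign (lookup S i)
  flipped : ∀ x → f (flip (flip x i) i) * χ S (flip x i) ≡ s * (f x * χ S x)
  flipped x = trans (cong₂ _*_ (cong f (flip-involutive x i)) (χ-flip S x i))
    (solve 3 (λ a s c → a :* (s :* c) := s :* (a :* c)) refl (f x) s (χ S x))

scaledCoeff-deriv : ∀ {n} (f : Fn n) S i →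
  scaledCoeff (deriv f i) S ≡ indicator (lookup S i) * scaledCoeff f S
scaledCoeff-deriv f S i = begin
  scaledCoeff (deriv f i) S
    ≡⟨ scaledCoeff-linear {h₁ = f} {h₂ = λ x → f (flip x i)} ½ (- ½)
         (λ x → solve 2 (λ u v → (u :- v) :* con ½ := con ½ :* u :+ con (- ½) :* v) refl (f x) (f (flip x i))) S ⟩
  ½ * scaledCoeff f S + (- ½) * scaledCoeff (λ x → f (flip x i)) S
    ≡⟨ cong (λ t → ½ * scaledCoeff f S + (- ½) * t) (scaledCoeff-flip f S i) ⟩
  ½ * scaledCoeff f S + (- ½) * (flipSign (lookup S i) * scaledCoeff f S)
    ≡⟨ half-difference (lookup S i) (scaledCoeff f S) ⟩
  indicator (lookup S i) * scaledCoeff f S ∎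
  where
  half-difference : ∀ s a → ½ * a + (- ½) * (flipSign s * a) ≡ indicator s * a
  half-difference inside  a = solve 1 (λ a → con ½ :* a :+ con (- ½) :* (con (- 1ℚ) :* a) := con 1ℚ :* a) refl a
  half-difference outside a = solve 1 (λ a → con ½ :* a :+ con (- ½) :* (con 1ℚ :* a) := con 0ℚ :* a) refl a

laplacian : ∀ {n} → Fn n → Fn n
laplacian {n} f x = Σᵢ n (λ i → deriv f i x)

Σᵢ-indicator : ∀ n (S : Subset n) → Σᵢ n (λ i → indicator (lookup S i)) ≡ ℕtoℚ ∣ S ∣ₛ
Σᵢ-indicator zero    []            = refl
Σᵢ-indicator (suc n) (inside  ∷ S) = trans (Σᵢ-suc n (indicator ∘ lookup (inside ∷ S)))
  (trans (cong (1ℚ +_) (Σᵢ-indicator n S)) (sym (ℕtoℚ-+ 1 ∣ S ∣ₛ)))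
Σᵢ-indicator (suc n) (outside ∷ S) = trans (Σᵢ-suc n (indicator ∘ lookup (outside ∷ S))) (trans (+-identityˡ _) (Σᵢ-indicator n S))

scaledCoeff-laplacian : ∀ {n} (f : Fn n) S → scaledCoeff (laplacian f) S ≡ ℕtoℚ ∣ S ∣ₛ * scaledCoeff f S
scaledCoeff-laplacian {n} f S = begin
  cubeSum n (λ x → Σᵢ n (λ i → deriv f i x) * χ S x)
    ≡⟨ sumOf-cong (λ x → sumOf-*ʳ (χ S x) (λ i → deriv f i x) (allFin n)) (allPoints n) ⟨
  cubeSum n (λ x → Σᵢ n (λ i → deriv f i x * χ S x))
    ≡⟨ sumOf-swap (λ x i → deriv f i x * χ S x) (allPoints n) (allFin n) ⟩
  Σᵢ n (λ i → scaledCoeff (deriv f i) S)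
    ≡⟨ sumOf-cong (scaledCoeff-deriv f S) (allFin n) ⟩
  Σᵢ n (λ i → indicator (lookup S i) * scaledCoeff f S)
    ≡⟨ sumOf-*ʳ (scaledCoeff f S) (λ i → indicator (lookup S i)) (allFin n) ⟩
  Σᵢ n (λ i → indicator (lookup S i)) * scaledCoeff f S
    ≡⟨ cong (_* scaledCoeff f S) (Σᵢ-indicator n S) ⟩
  ℕtoℚ ∣ S ∣ₛ * scaledCoeff f S ∎

scaledCoeff-outside : ∀ {n} (g : Fn (suc n)) S →
  scaledCoeff g (outside ∷ S) ≡ scaledCoeff (λ y → g (true ∷ y)) S + scaledCoeff (λ y → g (false ∷ y)) S
scaledCoeff-outside {n} g S = cubeSum-suc n (λ x → g x * χ (outside ∷ S) x)

scaledCoeff-inside : ∀ {n} (g : Fn (suc n)) S →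
  scaledCoeff g (inside ∷ S) ≡ scaledCoeff (λ y → g (true ∷ y)) S - scaledCoeff (λ y → g (false ∷ y)) S
scaledCoeff-inside {n} g S = begin
  scaledCoeff g (inside ∷ S)
    ≡⟨ cubeSum-suc n (λ x → g x * χ (inside ∷ S) x) ⟩
  cubeSum n (λ y → g (true ∷ y) * (1ℚ * χ S y)) + cubeSum n (λ y → g (false ∷ y) * (- 1ℚ * χ S y))
    ≡⟨ cong₂ _+_ (sumOf-cong (λ y → cong (g (true ∷ y) *_) (*-identityˡ (χ S y))) (allPoints n))
                 (sumOf-cong (λ y → solve 2 (λ a c → a :* (con (- 1ℚ) :* c) := con (- 1ℚ) :* (a :* c))
                                             refl (g (false ∷ y)) (χ S y)) (allPoints n)) ⟩
  scaledCoeff gT S + cubeSum n (λ y → - 1ℚ * (gF y * χ S y))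
    ≡⟨ cong (scaledCoeff gT S +_) (sumOf-*ˡ (- 1ℚ) (λ y → gF y * χ S y) (allPoints n)) ⟩
  scaledCoeff gT S + - 1ℚ * scaledCoeff gF S
    ≡⟨ solve 2 (λ a b → a :+ con (- 1ℚ) :* b := a :- b) refl (scaledCoeff gT S) (scaledCoeff gF S) ⟩
  scaledCoeff gT S - scaledCoeff gF S ∎
  where
  gT gF : Fn n
  gT y = g (true ∷ y)
  gF y = g (false ∷ y)

p+q≡0∧p-q≡0⇒p≡0∧q≡0 : ∀ {p q} → p + q ≡ 0ℚ → p - q ≡ 0ℚ → p ≡ 0ℚ × q ≡ 0ℚ
p+q≡0∧p-q≡0⇒p≡0∧q≡0 {p} {q} p+q≡0 p-q≡0 =
  trans (solve 2 (λ p q → p := con ½ :* ((p :+ q) :+ (p :- q))) refl p q) (cong₂ (λ u v → ½ * (u + v)) p+q≡0 p-q≡0) ,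
  trans (solve 2 (λ p q → q := con ½ :* ((p :+ q) :- (p :- q))) refl p q) (cong₂ (λ u v → ½ * (u - v)) p+q≡0 p-q≡0)

scaledCoeff≡0⇒≡0 : ∀ n (g : Fn n) → (∀ S → scaledCoeff g S ≡ 0ℚ) → ∀ x → g x ≡ 0ℚ
scaledCoeff≡0⇒≡0 zero    g ĝ≡0 [] = trans (solve 1 (λ a → a := a :* con 1ℚ :+ con 0ℚ) refl (g [])) (ĝ≡0 [])
scaledCoeff≡0⇒≡0 (suc n) g ĝ≡0 (b ∷ x) = restriction≡0 b
  where
  restrictions≡0 : ∀ S → scaledCoeff (λ y → g (true ∷ y)) S ≡ 0ℚ × scaledCoeff (λ y → g (false ∷ y)) S ≡ 0ℚ
  restrictions≡0 S = p+q≡0∧p-q≡0⇒p≡0∧q≡0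
    (trans (sym (scaledCoeff-outside g S)) (ĝ≡0 (outside ∷ S)))
    (trans (sym (scaledCoeff-inside g S)) (ĝ≡0 (inside ∷ S)))
  restriction≡0 : ∀ b → g (b ∷ x) ≡ 0ℚ
  restriction≡0 true  = scaledCoeff≡0⇒≡0 n (λ y → g (true ∷ y)) (proj₁ ∘ restrictions≡0) x
  restriction≡0 false = scaledCoeff≡0⇒≡0 n (λ y → g (false ∷ y)) (proj₂ ∘ restrictions≡0) x

scaledCoeff-laplacian-homogeneous : ∀ {n d} (f : Fn n) → (∀ S → coeff f S ≢ 0ℚ → ∣ S ∣ₛ ≡ d) →
  ∀ S → scaledCoeff (laplacian f) S ≡ ℕtoℚ d * scaledCoeff f S
scaledCoeff-laplacian-homogeneous {d = d} f degree≡d S with coeff f S ≟ 0ℚ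
... | yes coeff≡0 = trans (scaledCoeff-laplacian f S)
  (subst (λ a → ℕtoℚ ∣ S ∣ₛ * a ≡ ℕtoℚ d * a) (sym (coeff≡0⇒scaledCoeff≡0 f S coeff≡0))
    (trans (*-zeroʳ (ℕtoℚ ∣ S ∣ₛ)) (sym (*-zeroʳ (ℕtoℚ d)))))
... | no coeff≢0 = trans (scaledCoeff-laplacian f S) (cong (λ m → ℕtoℚ m * scaledCoeff f S) (degree≡d S coeff≢0))

laplacian-homogeneous : ∀ {n d} (f : Fn n) → (∀ S → coeff f S ≢ 0ℚ → ∣ S ∣ₛ ≡ d) →
  ∀ x → laplacian f x ≡ ℕtoℚ d * f x
laplacian-homogeneous {n} {d} f degree≡d x = begin
  laplacian f x                  ≡⟨ solve 3 (λ l D a → l := (l :- D :* a) :+ D :* a) refl (laplacian f x) D (f x) ⟩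
  residual x + D * f x           ≡⟨ cong (_+ D * f x) (scaledCoeff≡0⇒≡0 n residual residual^≡0 x) ⟩
  0ℚ + D * f x                   ≡⟨ +-identityˡ (D * f x) ⟩
  D * f x                        ∎
  where
  D = ℕtoℚ d
  residual : Fn n
  residual y = laplacian f y - D * f y
  residual^≡0 : ∀ S → scaledCoeff residual S ≡ 0ℚ
  residual^≡0 S = begin
    scaledCoeff residual S
      ≡⟨ scaledCoeff-linear {h₁ = laplacian f} {h₂ = f} 1ℚ (- D)
           (λ y → solve 3 (λ l D a → l :- D :* a := con 1ℚ :* l :+ (:- D) :* a) refl (laplacian f y) D (f y)) S ⟩
    1ℚ * scaledCoeff (laplacian f) S + (- D) * scaledCoeff f S
      ≡⟨ cong (λ t → 1ℚ * t + (- D) * scaledCoeff f S) (scaledCoeff-laplacian-homogeneous f degree≡d S) ⟩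
    1ℚ * (D * scaledCoeff f S) + (- D) * scaledCoeff f S
      ≡⟨ solve 2 (λ D a → con 1ℚ :* (D :* a) :+ (:- D) :* a := con 0ℚ) refl D (scaledCoeff f S) ⟩
    0ℚ ∎

IsSign : ℚ → Set
IsSign p = p ≡ 1ℚ ⊎ p ≡ - 1ℚ

∣[p-q]½∣≡p[p-q]½ : ∀ {p q} → IsSign p → IsSign q → ∣ (p - q) * ½ ∣ ≡ p * ((p - q) * ½)
∣[p-q]½∣≡p[p-q]½ (inj₁ refl) (inj₁ refl) = refl
∣[p-q]½∣≡p[p-q]½ (inj₁ refl) (inj₂ refl) = refl
∣[p-q]½∣≡p[p-q]½ (inj₂ refl) (inj₁ refl) = refl
∣[p-q]½∣≡p[p-q]½ (inj₂ refl) (inj₂ refl) = refl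

p[cp]≡c : ∀ {p} c → IsSign p → p * (c * p) ≡ c
p[cp]≡c c (inj₁ refl) = solve 1 (λ c → con 1ℚ :* (c :* con 1ℚ) := c) refl c
p[cp]≡c c (inj₂ refl) = solve 1 (λ c → con (- 1ℚ) :* (c :* con (- 1ℚ)) := c) refl c

Δ≡f*laplacian : ∀ {n} (f : Fn n) → IsBoolean f → ∀ x → Δ f x ≡ f x * laplacian f x
Δ≡f*laplacian {n} f boolean x = trans
  (sumOf-cong (λ i → ∣[p-q]½∣≡p[p-q]½ (boolean x) (boolean (flip x i))) (allFin n))
  (sumOf-*ˡ (f x) (λ i → deriv f i x) (allFin n))

Inf≡𝔼Δ : ∀ {n} (f : Fn n) → Inf f ≡ 𝔼 n (Δ f)
Inf≡𝔼Δ {n} f = begin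
  Σᵢ n (λ i → cubeSum n (λ x → ∣ deriv f i x ∣) * uniformWeight n)
    ≡⟨ sumOf-*ʳ (uniformWeight n) (λ i → cubeSum n (λ x → ∣ deriv f i x ∣)) (allFin n) ⟩
  Σᵢ n (λ i → cubeSum n (λ x → ∣ deriv f i x ∣)) * uniformWeight n
    ≡⟨ cong (_* uniformWeight n) (sumOf-swap (λ x i → ∣ deriv f i x ∣) (allPoints n) (allFin n)) ⟨
  cubeSum n (Δ f) * uniformWeight n ∎

supNorm-const : ∀ {n} {g : Cube n → ℚ} {c} → (∀ x → g x ≡ c) → supNorm g ≡ ∣ c ∣
supNorm-const {n} {g} {c} g≡c = foldr≡∣c∣ (allPoints n)
  where
  foldr≡∣c∣ : ∀ xs → foldr (λ x m → ∣ g x ∣ ⊔ m) ∣ g (replicate n true) ∣ xs ≡ ∣ c ∣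
  foldr≡∣c∣ []       = cong ∣_∣ (g≡c (replicate n true))
  foldr≡∣c∣ (x ∷ xs) = trans (cong₂ _⊔_ (cong ∣_∣ (g≡c x)) (foldr≡∣c∣ xs)) (⊔-idem ∣ c ∣)

proposition3p7 : (n d : ℕ) (f : Fn n) → IsBoolean f → IsHomogeneousOfDegree f d
    → ((x : Cube n) → Δ f x ≡ ℕtoℚ d) × (Inf f ≡ ℕtoℚ d) × (supNorm (Δ f) ≡ ℕtoℚ d)
proposition3p7 n d f boolean (_ , degree≡d) = Δ≡d , Inf≡d , supNorm≡d
  where
  Δ≡d : ∀ x → Δ f x ≡ ℕtoℚ d
  Δ≡d x = begin
    Δ f x                  ≡⟨ Δ≡f*laplacian f boolean x ⟩
    f x * laplacian f x    ≡⟨ cong (f x *_) (laplacian-homogeneous f degree≡d x) ⟩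
    f x * (ℕtoℚ d * f x)   ≡⟨ p[cp]≡c (ℕtoℚ d) (boolean x) ⟩
    ℕtoℚ d                 ∎
  Inf≡d : Inf f ≡ ℕtoℚ d
  Inf≡d = trans (Inf≡𝔼Δ f) (𝔼-const n Δ≡d)
  supNorm≡d : supNorm (Δ f) ≡ ℕtoℚ d
  supNorm≡d = trans (supNorm-const Δ≡d) (∣ℕtoℚ∣ d)
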